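{- $\mathbb{P}(G_3)$ is paraconsistent: there exist $\Gamma\subseteq For$ and $\alpha\in For$ such that $\{\alpha,\neg\alpha\}\subseteq Cn^{\mathbb{P}}_{G_3}(\Gamma)$ but $Cn^{\mathbb{P}}_{G_3}(\Gamma)\neq For$.
   Context: $For$ is the set of formulas built from a countable set $Prop$ of propositional letters with $\neg,\vee,\wedge,\rightarrow$. $G_3$ (Gödel) is given by the matrix with truth values $\{0,1/2,1\}$, designated set $\{1\}$, $f_\neg(0)=1$ and $f_\neg(x)=0$ for $x\neq 0$, $f_\vee=\max$, $f_\wedge=\min$, $f_\rightarrow(x,y)=1$ if $x\le y$ and $f_\rightarrow(x,y)=y$ if $x>y$; valuations are maps $Prop\to\{0,1/2,1\}$ extended via these functions. $\Gamma\vDash_{G_3}\alpha$ iff every valuation giving all members of $\Gamma$ value $1$ gives $\alpha$ value $1$; $\Gamma$ is $G_3$-consistent iff $\{\alpha:\Gamma\vDash_{G_3}\alpha\}\neq For$. $\Gamma\vDash^{\mathbb{P}}_{G_3}\alpha$ iff there exists a $G_3$-consistent $\Gamma'\subseteq\Gamma$ with $\Gamma'\vDash_{G_3}\alpha$; $Cn^{\mathbb{P}}_{G_3}(\Gamma)=\{\alpha:\Gamma\vDash^{\mathbb{P}}_{G_3}\alpha\}$. -}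

module Defs where

open import Data.Nat using (ℕ)
open import Data.Product using (Σ; _×_)
open import Relation.Binary.PropositionalEquality using (_≡_)
open import Relation.Nullary using (¬_)
open import Level using (Level; suc; zero)

Prop : Set
Prop = ℕ

data For : Set where
  var  : Prop → For
  neg  : For → For
  _∨'_ : For → For → For
  _∧'_ : For → For → For
  _⇒'_ : For → For → For

-- Truth values {0, 1/2, 1}.
data V3 : Set where
  v0 vh v1 : V3

f¬ : V3 → V3
f¬ v0 = v1
f¬ _  = v0

f∨ : V3 → V3 → V3
f∨ v0 y = y
f∨ vh v1 = v1
f∨ vh _  = vh
f∨ v1 _  = v1

f∧ : V3 → V3 → V3
f∧ v0 _ = v0
f∧ vh v0 = v0
f∧ vh _  = vh
f∧ v1 y  = y

f⇒ : V3 → V3 → V3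
f⇒ v0 _  = v1
f⇒ vh v0 = v0
f⇒ vh _  = v1
f⇒ v1 y  = y

Valuation : Set
Valuation = Prop → V3

eval : Valuation → For → V3
eval v (var p)  = v p
eval v (neg a)  = f¬ (eval v a)
eval v (a ∨' b) = f∨ (eval v a) (eval v b)
eval v (a ∧' b) = f∧ (eval v a) (eval v b)
eval v (a ⇒' b) = f⇒ (eval v a) (eval v b)

FSet : Set₁
FSet = For → Set

_⊆_ : FSet → FSet → Set
Γ ⊆ Δ = ∀ a → Γ a → Δ a

_⊨G3_ : FSet → For → Set
Γ ⊨G3 α = ∀ (v : Valuation) → (∀ b → Γ b → eval v b ≡ v1) → eval v α ≡ v1

Consistent : FSet → Set
Consistent Γ = ¬ (∀ (α : For) → Γ ⊨G3 α)

_⊨P_ : FSet → For → Set₁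
Γ ⊨P α = Σ FSet (λ Γ' → (Γ' ⊆ Γ) × Consistent Γ' × (Γ' ⊨G3 α))

CnP : FSet → For → Set₁
CnP Γ α = Γ ⊨P α

-- Take Γ = {p, ¬p}. The consistent subsets {p} and {¬p} put p and ¬p into Cn^P(Γ). A
-- letter q stays outside: a consistent Γ' ⊆ Γ cannot contain both p and ¬p, as no valuation
-- designates both, and neither {p} nor {¬p} entails q.
module Submission where

open import Defs
open import Data.Product using (Σ; _×_; _,_)
open import Data.Sum using (inj₁; inj₂)
open import Data.Nat using (zero; suc)
open import Relation.Binary.PropositionalEquality using (_≡_; _≢_; refl)
open import Relation.Nullary using (¬_; contradiction)
open import Relation.Unary using (｛_｝; _∪_)

designated⇒neg-undesignated : ∀ v a → eval v a ≡ v1 → eval v (neg a) ≢ v1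
designated⇒neg-undesignated v a h rewrite h = λ ()

∈⇒⊨G3 : ∀ {Δ a} → Δ a → Δ ⊨G3 a
∈⇒⊨G3 {a = a} a∈Δ v v⊨Δ = v⊨Δ a a∈Δ

⊨G3-weaken : ∀ {Δ Δ′} α → Δ ⊆ Δ′ → Δ ⊨G3 α → Δ′ ⊨G3 α
⊨G3-weaken _ Δ⊆Δ′ Δ⊨α v v⊨Δ′ = Δ⊨α v (λ b b∈Δ → v⊨Δ′ b (Δ⊆Δ′ b b∈Δ))

countermodel⇒⊭G3 : ∀ {Δ} β v → (∀ b → Δ b → eval v b ≡ v1) → eval v β ≢ v1 → ¬ Δ ⊨G3 β
countermodel⇒⊭G3 _ v v⊨Δ v⊭β Δ⊨β = v⊭β (Δ⊨β v v⊨Δ)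

⊭G3⇒Consistent : ∀ {Δ} β → ¬ Δ ⊨G3 β → Consistent Δ
⊭G3⇒Consistent β Δ⊭β Δ⊨all = Δ⊭β (Δ⊨all β)

contradictory⇒explosive : ∀ {Δ a} → Δ a → Δ (neg a) → ∀ β → Δ ⊨G3 β
contradictory⇒explosive {a = a} a∈Δ ¬a∈Δ β v v⊨Δ =
  contradiction (v⊨Δ (neg a) ¬a∈Δ) (designated⇒neg-undesignated v a (v⊨Δ a a∈Δ))

¬¬contradictory⇒inconsistent : ∀ {Δ a} → ¬ ¬ Δ a → ¬ ¬ Δ (neg a) → ¬ Consistent Δ
¬¬contradictory⇒inconsistent ¬¬a∈Δ ¬¬¬a∈Δ consistent =
  ¬¬a∈Δ λ a∈Δ → ¬¬¬a∈Δ λ ¬a∈Δ → consistent (contradictory⇒explosive a∈Δ ¬a∈Δ)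

⊆-∪-dropˡ : ∀ {Δ B a} → Δ ⊆ (｛ a ｝ ∪ B) → ¬ Δ a → Δ ⊆ B
⊆-∪-dropˡ Δ⊆aB a∉Δ b b∈Δ with Δ⊆aB b b∈Δ
... | inj₁ refl = contradiction b∈Δ a∉Δ
... | inj₂ b∈B  = b∈B

⊆-∪-dropʳ : ∀ {Δ A a} → Δ ⊆ (A ∪ ｛ a ｝) → ¬ Δ a → Δ ⊆ A
⊆-∪-dropʳ Δ⊆Aa a∉Δ b b∈Δ with Δ⊆Aa b b∈Δ
... | inj₁ b∈A  = b∈A
... | inj₂ refl = contradiction b∈Δ a∉Δ

p q : For
p = var 0
q = var 1

Γ : FSet
Γ = ｛ p ｝ ∪ ｛ neg p ｝

p↦_ : V3 → Valuation
(p↦ x) zero    = x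
(p↦ x) (suc _) = v0

p⊭q : ¬ ｛ p ｝ ⊨G3 q
p⊭q = countermodel⇒⊭G3 q (p↦ v1) (λ { _ refl → refl }) λ ()

¬p⊭q : ¬ ｛ neg p ｝ ⊨G3 q
¬p⊭q = countermodel⇒⊭G3 q (p↦ v0) (λ { _ refl → refl }) λ ()

q∉CnPΓ : ¬ CnP Γ q
q∉CnPΓ (Δ , Δ⊆Γ , consistent , Δ⊨q) = ¬¬contradictory⇒inconsistent
  (λ p∉Δ → ¬p⊭q (⊨G3-weaken q (⊆-∪-dropˡ Δ⊆Γ p∉Δ) Δ⊨q))
  (λ ¬p∉Δ → p⊭q (⊨G3-weaken q (⊆-∪-dropʳ Δ⊆Γ ¬p∉Δ) Δ⊨q))
  consistent

proposition14 : Σ FSet (λ Γ → Σ For (λ α →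
    (CnP Γ α × CnP Γ (neg α)) × ¬ (∀ (β : For) → CnP Γ β)))
proposition14 = Γ , p ,
  ( (｛ p ｝ , (λ _ → inj₁) , ⊭G3⇒Consistent q p⊭q , ∈⇒⊨G3 refl)
  , (｛ neg p ｝ , (λ _ → inj₂) , ⊭G3⇒Consistent q ¬p⊭q , ∈⇒⊨G3 refl) )
  , λ CnPΓ-total → q∉CnPΓ (CnPΓ-total q)
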